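{- Let $k\ge 1$, $1\le p\le k$, let $m_1,\ldots,m_k$ be integers and $n\ge 0$. Then \[\mathcal{D}_k(m_1,\ldots,m_{p-1},m_p,m_{p+1},\ldots,m_k;n)=\mathcal{D}_k(m_1,\ldots,m_{p-1},-m_p,m_{p+1},\ldots,m_k;n).\]
   Context: A partition is a finite nonincreasing sequence of positive integers; $l(\lambda)$ is the number of parts, $|\lambda|$ the sum, $\lambda_1$ the largest part ($0$ if empty). For $k\geq 1$, a $k$-marked Durfee symbol of $n$ is an array $\eta=\begin{pmatrix}\alpha^k,&\ldots,&\alpha^1\\ \beta^k,&\ldots,&\beta^1\end{pmatrix}_D$ where $D\ge 0$ is an integer, each $\alpha^i,\beta^i$ is a (possibly empty) partition, $\sum_{i}(|\alpha^i|+|\beta^i|)+D^2=n$, and: (1) $\alpha^i$ is nonempty for $1\leq i<k$; (2) for $2\le i\le k$, $\beta^{i-1}_1\le \alpha^{i-1}_1$ and $\alpha^{i-1}_1$ is at most every part of $\alpha^i$ and of $\beta^i$; (3) every part of $\alpha^k$ and $\beta^k$ is at most $D$. Its $i$th rank is $l(\alpha^i)-l(\beta^i)-1$ for $1\le i<k$ and $l(\alpha^k)-l(\beta^k)$ for $i=k$. $\mathcal{D}_k(m_1,\ldots,m_k;n)$ is the number of $k$-marked Durfee symbols of $n$ with $i$th rank $m_i$ for all $i$. -}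

module Defs where

open import Data.Nat using (ℕ; zero; suc; _+_; _*_; _≤_; _≥_)
open import Data.Integer using (ℤ; -_) renaming (_-_ to _-ℤ_; +_ to ⁺_)
open import Data.List using (List; []; _∷_; length)
open import Data.Nat.ListAction using (sum)
open import Data.Unit using (⊤)
open import Data.List.Relation.Unary.All using (All)
open import Data.List.Relation.Unary.Linked using (Linked)
open import Data.Vec using (Vec; []; _∷_)
open import Data.Product using (Σ; _×_; _,_)
open import Relation.Binary.PropositionalEquality using (_≡_)

IsPartition : List ℕ → Set
IsPartition xs = Linked _≥_ xs × All (λ x → 1 ≤ x) xs

largest : List ℕ → ℕ
largest []      = 0
largest (x ∷ _) = x

Nonempty : List ℕ → Set
Nonempty xs = 1 ≤ length xs

-- A column (α^i, β^i) of a marked Durfee symbol.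
Col : Set
Col = List ℕ × List ℕ

-- The columns are stored in the order (α^1,β^1), (α^2,β^2), …, (α^k,β^k).
-- Conditions (1)-(3) of the definition, given the Durfee square side D.
data Chain (D : ℕ) : {k : ℕ} → Vec Col k → Set where
  last : ∀ {α β} →
         All (λ x → x ≤ D) α → All (λ x → x ≤ D) β →
         Chain D ((α , β) ∷ [])
  step : ∀ {k α β α′ β′} {rest : Vec Col k} →
         Nonempty α →
         largest β ≤ largest α →
         All (λ x → largest α ≤ x) α′ →
         All (λ x → largest α ≤ x) β′ →
         Chain D ((α′ , β′) ∷ rest) →
         Chain D ((α , β) ∷ (α′ , β′) ∷ rest)

AllPartitions : {k : ℕ} → Vec Col k → Set
AllPartitions []             = ⊤
AllPartitions ((α , β) ∷ cs) = IsPartition α × IsPartition β × AllPartitions cs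

weight : {k : ℕ} → Vec Col k → ℕ
weight []             = 0
weight ((α , β) ∷ cs) = sum α + sum β + weight cs

record MarkedDurfee (k n : ℕ) : Set where
  constructor mkMD
  field
    D      : ℕ
    cols   : Vec Col k
    parts  : AllPartitions cols
    chain  : Chain D cols
    size   : weight cols + D * D ≡ n

lenDiff : Col → ℤ
lenDiff (α , β) = ⁺ length α -ℤ ⁺ length β

ranksV : {k : ℕ} → Vec Col k → Vec ℤ k
ranksV []                 = []
ranksV (c ∷ [])           = lenDiff c ∷ []
ranksV (c ∷ c′ ∷ cs)      = (lenDiff c -ℤ ⁺ 1) ∷ ranksV (c′ ∷ cs)

-- The set counted by 𝒟_k(m_1,…,m_k;n): k-marked Durfee symbols of n with rank vector ms.
MarkedDurfeeWithRanks : (k : ℕ) → Vec ℤ k → ℕ → Set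
MarkedDurfeeWithRanks k ms n = Σ (MarkedDurfee k n) (λ η → ranksV (MarkedDurfee.cols η) ≡ ms)

module Submission where

-- We exhibit an involution on the columns of a marked Durfee symbol that
-- negates the p-th rank and fixes everything else:
--   * if p is the last column, exchange α^k and β^k;
--   * otherwise α^p = M ∷ α′ is nonempty, and we send (M ∷ α′ , β^p) to
--     (M ∷ β^p , α′): the largest part M stays in the top row, the rest of
--     the two rows is exchanged.  Since β^p₁ ≤ M, the new top row is still a
--     partition with largest part M, so conditions (1)-(3) are unaffected.  Since all the
-- proof components of a symbol are propositions, a symbol is determined by
-- its Durfee side and columns, so flipAt p induces the required bijection.

open import Defs
open import Data.Nat using (ℕ; _≤_)
open import Data.Integer using (ℤ; -_)
open import Data.Fin using (Fin)
open import Data.Vec using (Vec; _[_]%=_)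
open import Function.Bundles using (_↔_)

open import Data.Nat as ℕ using (suc; z≤n; s≤s; _+_; _*_; _≥_)
import Data.Nat.Properties as ℕP
open import Data.Integer as ℤ using () renaming (+_ to ⁺_)
import Data.Integer.Properties as ℤP
open import Data.Integer.Tactic.RingSolver using (solve-∀)
open import Data.Fin as Fin using ()
open import Data.List using (List; []; _∷_; length)
open import Data.Nat.ListAction using (sum)
open import Data.Vec as Vec using ([]; _∷_)
import Data.Vec.Properties as VecP
open import Data.Product using (_×_; _,_; proj₁; proj₂)
open import Data.Unit using (tt)
open import Data.List.Relation.Unary.All as All using (All)
open import Data.List.Relation.Unary.Linked as Linked using (Linked)
open import Relation.Binary.PropositionalEquality
open import Axiom.UniquenessOfIdentityProofs using (module Decidable⇒UIP)
open import Function.Bundles using (mk↔ₛ′)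

swapRows : Col → Col
swapRows (α , β) = (β , α)

-- An inner column keeps its largest top part M and exchanges the rest.
-- (On an empty top row it is the identity; inner columns never have one.)
swapBelowMark : Col → Col
swapBelowMark ([]    , β) = ([] , β)
swapBelowMark (M ∷ α , β) = (M ∷ β , α)

swapBelowMark-involutive : ∀ c → swapBelowMark (swapBelowMark c) ≡ c
swapBelowMark-involutive ([]    , β) = refl
swapBelowMark-involutive (M ∷ α , β) = refl

-- Both rows of a column satisfy Q.  Both maps only rearrange the parts of a
-- column, so they preserve every such condition (e.g. the bounds in (2),(3)).
AllParts : (ℕ → Set) → Col → Set
AllParts Q (α , β) = All Q α × All Q β

swapRows-AllParts : ∀ {Q} c → AllParts Q c → AllParts Q (swapRows c)
swapRows-AllParts _ (qα , qβ) = qβ , qα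

swapBelowMark-AllParts : ∀ {Q} c → AllParts Q c → AllParts Q (swapBelowMark c)
swapBelowMark-AllParts ([]    , β) qs                  = qs
swapBelowMark-AllParts (M ∷ α , β) (qM All.∷ qα , qβ) = qM All.∷ qβ , qα

columnSum : Col → ℕ
columnSum (α , β) = sum α + sum β

swapRows-columnSum : ∀ c → columnSum (swapRows c) ≡ columnSum c
swapRows-columnSum (α , β) = ℕP.+-comm (sum β) (sum α)

swapBelowMark-columnSum : ∀ c → columnSum (swapBelowMark c) ≡ columnSum c
swapBelowMark-columnSum ([]    , β) = refl
swapBelowMark-columnSum (M ∷ α , β) = begin
  M + sum β + sum α   ≡⟨ ℕP.+-assoc M (sum β) (sum α) ⟩
  M + (sum β + sum α) ≡⟨ cong (M +_) (ℕP.+-comm (sum β) (sum α)) ⟩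
  M + (sum α + sum β) ≡⟨ ℕP.+-assoc M (sum α) (sum β) ⟨
  M + sum α + sum β   ∎
  where open ≡-Reasoning

swapRows-rank : ∀ c → lenDiff (swapRows c) ≡ - lenDiff c
swapRows-rank (α , β) = difference-antisymmetric (⁺ length α) (⁺ length β)
  where
  difference-antisymmetric : ∀ (a b : ℤ) → b ℤ.- a ≡ - (a ℤ.- b)
  difference-antisymmetric = solve-∀

-- Rank of an inner column: l(α) - l(β) - 1, negated by swapBelowMark
-- because the top row keeps the marked part M.
swapBelowMark-rank : ∀ c → Nonempty (proj₁ c) →
  lenDiff (swapBelowMark c) ℤ.- ⁺ 1 ≡ - (lenDiff c ℤ.- ⁺ 1)
swapBelowMark-rank (M ∷ α , β) _ = marked-antisymmetric (⁺ length α) (⁺ length β)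
  where
  marked-antisymmetric : ∀ (a b : ℤ) →
    (⁺ 1 ℤ.+ b ℤ.- a) ℤ.- ⁺ 1 ≡ - ((⁺ 1 ℤ.+ a ℤ.- b) ℤ.- ⁺ 1)
  marked-antisymmetric = solve-∀

largest-tail≤head : ∀ {M α} → Linked _≥_ (M ∷ α) → largest α ≤ M
largest-tail≤head {α = []}    _                = z≤n
largest-tail≤head {α = x ∷ α} (M≥x Linked.∷ _) = M≥x

cons-partition : ∀ {M β} → Linked _≥_ β → largest β ≤ M → Linked _≥_ (M ∷ β)
cons-partition Linked.[]          _   = Linked.[-]
cons-partition Linked.[-]         M≥x = M≥x Linked.∷ Linked.[-]
cons-partition (x≥y Linked.∷ xs) M≥x = M≥x Linked.∷ x≥y Linked.∷ xs

-- An inner column satisfying condition (2) with its successor is sent by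
-- swapBelowMark to partitions still satisfying (2); the successor's bounds
-- are unchanged because the largest top part M is kept.
swapBelowMark-valid : ∀ {D k α β} {rest : Vec Col (suc k)} →
  IsPartition α → IsPartition β → Chain D ((α , β) ∷ rest) →
  IsPartition (proj₁ (swapBelowMark (α , β))) ×
  IsPartition (proj₂ (swapBelowMark (α , β))) ×
  Chain D (swapBelowMark (α , β) ∷ rest)
swapBelowMark-valid {α = []} _ _ (Chain.step () _ _ _ _)
swapBelowMark-valid {α = M ∷ α} (M∷α↘ , M≥1 All.∷ α≥1) (β↘ , β≥1)
                    (Chain.step _ β₁≤M restα restβ chain) =
  (cons-partition β↘ β₁≤M , M≥1 All.∷ β≥1) ,
  (Linked.tail M∷α↘ , α≥1) ,
  Chain.step (s≤s z≤n) (largest-tail≤head M∷α↘) restα restβ chain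

prependColumn : ∀ {D k α β} (w : Vec Col (suc k)) →
  Nonempty α → largest β ≤ largest α →
  AllParts (largest α ≤_) (Vec.head w) → Chain D w → Chain D ((α , β) ∷ w)
prependColumn ((α′ , β′) ∷ rest) ne β₁≤α₁ (boundα , boundβ) chain =
  Chain.step ne β₁≤α₁ boundα boundβ chain

flipAt : {k : ℕ} → Fin k → Vec Col k → Vec Col k
flipAt Fin.zero    (c ∷ [])     = swapRows c ∷ []
flipAt Fin.zero    (c ∷ c′ ∷ cs) = swapBelowMark c ∷ c′ ∷ cs
flipAt (Fin.suc p) (c ∷ cs)     = c ∷ flipAt p cs

flipAt-involutive : ∀ {k} (p : Fin k) v → flipAt p (flipAt p v) ≡ v
flipAt-involutive Fin.zero    (c ∷ [])     = refl
flipAt-involutive Fin.zero    (c ∷ c′ ∷ cs) = cong (_∷ c′ ∷ cs) (swapBelowMark-involutive c)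
flipAt-involutive (Fin.suc p) (c ∷ cs)     = cong (c ∷_) (flipAt-involutive p cs)

-- The first column of flipAt p v has the same parts as that of v, so it
-- still satisfies the lower bounds imposed by a preceding column.
flipAt-head : ∀ {Q k} (p : Fin (suc k)) v →
  AllParts Q (Vec.head v) → AllParts Q (Vec.head (flipAt p v))
flipAt-head Fin.zero    (c ∷ [])     = swapRows-AllParts c
flipAt-head Fin.zero    (c ∷ c′ ∷ cs) = swapBelowMark-AllParts c
flipAt-head (Fin.suc p) (c ∷ cs)     = λ qs → qs

flipAt-valid : ∀ {D k} (p : Fin k) v → AllPartitions v → Chain D v →
  AllPartitions (flipAt p v) × Chain D (flipAt p v)
flipAt-valid Fin.zero ((α , β) ∷ []) (α↘ , β↘ , tt) (Chain.last α≤D β≤D) =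
  (β↘ , α↘ , tt) , Chain.last β≤D α≤D
flipAt-valid Fin.zero ((α , β) ∷ c′ ∷ cs) (α↘ , β↘ , rest) chain
  with swapBelowMark-valid α↘ β↘ chain
... | α′↘ , β′↘ , chain′ = (α′↘ , β′↘ , rest) , chain′
flipAt-valid (Fin.suc p) ((α , β) ∷ c′ ∷ cs) (α↘ , β↘ , rest)
  (Chain.step ne β₁≤α₁ boundα boundβ chain) with flipAt-valid p (c′ ∷ cs) rest chain
... | rest′ , chain′ =
  (α↘ , β↘ , rest′) ,
  prependColumn (flipAt p (c′ ∷ cs)) ne β₁≤α₁
    (flipAt-head p (c′ ∷ cs) (boundα , boundβ)) chain′

flipAt-weight : ∀ {k} (p : Fin k) v → weight (flipAt p v) ≡ weight v
flipAt-weight Fin.zero    (c ∷ [])     = cong (_+ 0) (swapRows-columnSum c)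
flipAt-weight Fin.zero    (c ∷ c′ ∷ cs) = cong (_+ weight (c′ ∷ cs)) (swapBelowMark-columnSum c)
flipAt-weight (Fin.suc p) ((α , β) ∷ cs) = cong (sum α + sum β +_) (flipAt-weight p cs)

ranks-cons : ∀ {k} c (w : Vec Col (suc k)) →
  ranksV (c ∷ w) ≡ (lenDiff c ℤ.- ⁺ 1) ∷ ranksV w
ranks-cons c (c′ ∷ cs) = refl

flipAt-ranks : ∀ {D k} (p : Fin k) v → Chain D v →
  ranksV (flipAt p v) ≡ ranksV v [ p ]%= -_
flipAt-ranks Fin.zero (c ∷ []) _ = cong (_∷ []) (swapRows-rank c)
flipAt-ranks Fin.zero (c ∷ c′ ∷ cs) (Chain.step ne _ _ _ _) =
  cong (_∷ ranksV (c′ ∷ cs)) (swapBelowMark-rank c ne)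
flipAt-ranks (Fin.suc p) (c ∷ c′ ∷ cs) (Chain.step _ _ _ _ chain) = begin
  ranksV (c ∷ flipAt p (c′ ∷ cs))
    ≡⟨ ranks-cons c (flipAt p (c′ ∷ cs)) ⟩
  (lenDiff c ℤ.- ⁺ 1) ∷ ranksV (flipAt p (c′ ∷ cs))
    ≡⟨ cong ((lenDiff c ℤ.- ⁺ 1) ∷_) (flipAt-ranks p (c′ ∷ cs) chain) ⟩
  (lenDiff c ℤ.- ⁺ 1) ∷ (ranksV (c′ ∷ cs) [ p ]%= -_)
    ∎
  where open ≡-Reasoning

negateAt-involutive : ∀ {k} (p : Fin k) (ms : Vec ℤ k) → (ms [ p ]%= -_) [ p ]%= -_ ≡ ms
negateAt-involutive p ms =
  trans (VecP.[]%=-∘ ms p) (VecP.updateAt-id-local p ms (ℤP.neg-involutive _))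

IsPartition-irrelevant : ∀ {xs} (a b : IsPartition xs) → a ≡ b
IsPartition-irrelevant (a↘ , a≥1) (b↘ , b≥1) =
  cong₂ _,_ (Linked.irrelevant ℕP.≤-irrelevant a↘ b↘) (All.irrelevant ℕP.≤-irrelevant a≥1 b≥1)

AllPartitions-irrelevant : ∀ {k} {v : Vec Col k} (a b : AllPartitions v) → a ≡ b
AllPartitions-irrelevant {v = []}    tt           tt              = refl
AllPartitions-irrelevant {v = _ ∷ _} (aα , aβ , a) (bα , bβ , b) =
  cong₂ _,_ (IsPartition-irrelevant aα bα)
            (cong₂ _,_ (IsPartition-irrelevant aβ bβ) (AllPartitions-irrelevant a b))

Chain-irrelevant : ∀ {D k} {v : Vec Col k} (a b : Chain D v) → a ≡ b
Chain-irrelevant (Chain.last a b) (Chain.last a′ b′) =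
  cong₂ Chain.last (All.irrelevant ℕP.≤-irrelevant a a′) (All.irrelevant ℕP.≤-irrelevant b b′)
Chain-irrelevant (Chain.step a b c d e) (Chain.step a′ b′ c′ d′ e′)
  rewrite ℕP.≤-irrelevant a a′ | ℕP.≤-irrelevant b b′
        | All.irrelevant ℕP.≤-irrelevant c c′ | All.irrelevant ℕP.≤-irrelevant d d′
        | Chain-irrelevant e e′ = refl

rankVector-irrelevant : ∀ {k} {x y : Vec ℤ k} (a b : x ≡ y) → a ≡ b
rankVector-irrelevant = Decidable⇒UIP.≡-irrelevant (VecP.≡-dec ℤP._≟_)

symbol-≡ : ∀ {k ms n} (x y : MarkedDurfeeWithRanks k ms n) →
  MarkedDurfee.D (proj₁ x) ≡ MarkedDurfee.D (proj₁ y) →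
  MarkedDurfee.cols (proj₁ x) ≡ MarkedDurfee.cols (proj₁ y) → x ≡ y
symbol-≡ (mkMD D cols ps ch sz , r) (mkMD .D .cols ps′ ch′ sz′ , r′) refl refl
  rewrite AllPartitions-irrelevant ps ps′ | Chain-irrelevant ch ch′
        | ℕP.≡-irrelevant sz sz′ | rankVector-irrelevant r r′ = refl

flipSymbol : ∀ {k n} (p : Fin k) {ms ms′ : Vec ℤ k} → ms [ p ]%= -_ ≡ ms′ →
  MarkedDurfeeWithRanks k ms n → MarkedDurfeeWithRanks k ms′ n
flipSymbol p negated (mkMD D cols ps chain size , ranks≡ms) =
  mkMD D (flipAt p cols) (proj₁ valid) (proj₂ valid)
       (trans (cong (_+ D * D) (flipAt-weight p cols)) size) ,
  trans (flipAt-ranks p cols chain) (trans (cong (_[ p ]%= -_) ranks≡ms) negated)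
  where valid = flipAt-valid p cols ps chain

flipSymbol-involutive : ∀ {k n} (p : Fin k) {ms ms′ : Vec ℤ k}
  (e : ms [ p ]%= -_ ≡ ms′) (e′ : ms′ [ p ]%= -_ ≡ ms) (x : MarkedDurfeeWithRanks k ms n) →
  flipSymbol p e′ (flipSymbol p e x) ≡ x
flipSymbol-involutive p e e′ x@(mkMD _ cols _ _ _ , _) =
  symbol-≡ _ x refl (flipAt-involutive p cols)

theorem2p10 : (k : ℕ) → 1 ≤ k → (p : Fin k) → (ms : Vec ℤ k) → (n : ℕ) →
    MarkedDurfeeWithRanks k ms n ↔ MarkedDurfeeWithRanks k (ms [ p ]%= -_) n
theorem2p10 k _ p ms n =
  mk↔ₛ′ (flipSymbol p refl) (flipSymbol p negateTwice)
        (flipSymbol-involutive p negateTwice refl)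
        (flipSymbol-involutive p refl negateTwice)
  where
  negateTwice : (ms [ p ]%= -_) [ p ]%= -_ ≡ ms
  negateTwice = negateAt-involutive p ms
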